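{- For every marked graph $(G,\mathsf m)$ and every non-loop edge $e$ of $G$, $$M_{(G/e,\mathsf m/e)}(\mathbf z,y)=M_{(G,\mathsf m)\odot e}(\mathbf z,y)-M_{((G,\mathsf m)\odot e)\setminus\ell_e}(\mathbf z,y),$$ and the $M$-polynomial satisfies the deletion-near-contraction formula $$M_{(G,\mathsf m)}(\mathbf z,y)=M_{(G\setminus e,\mathsf m)}(\mathbf z,y)-M_{((G,\mathsf m)\odot e)\setminus\ell_e}(\mathbf z,y)+M_{(G,\mathsf m)\odot e}(\mathbf z,y).$$
   Context: Graphs are finite and may have loops and multiple edges. A mark is a pair $(w,d)$ of integers with $w\ge1,d\ge0,w\ge d+1$, with dot-sum $(w,d)\dotplus(w',d')=(w+w',d+d'+1)$. A marked graph is $(G,\mathsf m)$ with $\mathsf m$ assigning a mark to each vertex. Deletion $(G\setminus e,\mathsf m)$ removes $e$. Contraction of a non-loop edge $e=uv$: $(G/e,\mathsf m/e)$ deletes $e$ and merges $u,v$ into a new vertex $v_e$ inheriting all other edges incident with $u$ or $v$, with mark $\mathsf m(u)\dotplus\mathsf m(v)$, other marks unchanged. Near-contraction: if $\mathsf m(u)=(w_u,d_u)$, $\mathsf m(v)=(w_v,d_v)$, then $(G,\mathsf m)\odot e$ is obtained from $G/e$ by adding a new vertex $v'$ with mark $(1,0)$ and a new edge $\ell_e=v'v_e$, and giving $v_e$ the mark $(w_u+w_v-1,d_u+d_v)$ (other marks unchanged); $((G,\mathsf m)\odot e)\setminus\ell_e$ deletes $\ell_e$. The $M$-polynomial in commuting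 indeterminates $y$, $z_{w,d}$ is defined by: edgeless $G$ with marks $(w_i,d_i)$ gives $\prod_i z_{w_i,d_i}$; a loop $e$ gives $M_{(G,\mathsf m)}=y\,M_{(G\setminus e,\mathsf m)}$; a non-loop edge $e$ gives $M_{(G,\mathsf m)}=M_{(G\setminus e,\mathsf m)}+M_{(G/e,\mathsf m/e)}$ (this is well-defined). -}

module Defs where

open import Level using (Level)
open import Data.Nat using (ℕ; zero; suc; _+_; _∸_; _≤_; s≤s; z≤n)
open import Data.Nat.Properties using (+-mono-≤; +-suc; +-comm)
open import Data.Fin using (Fin; zero; suc; punchIn; punchOut)
open import Data.Fin.Properties using (_≟_; punchInᵢ≢i)
open import Data.Product using (_×_; _,_; proj₁; proj₂)
open import Data.Empty using (⊥-elim)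
open import Relation.Nullary using (¬_; yes; no)
open import Relation.Binary.PropositionalEquality using (_≡_; _≢_; refl; sym; subst)
open import Algebra.Bundles using (CommutativeRing)

record Mark : Set where
  constructor mark
  field
    w     : ℕ
    d     : ℕ
    valid : suc d ≤ w

open Mark public

dotLemma : ∀ {w d w' d'} → suc d ≤ w → suc d' ≤ w' → suc (d + d' + 1) ≤ w + w'
dotLemma {w} {d} {w'} {d'} p q =
  subst (_≤ w + w') eq (+-mono-≤ p q)
  where
  eq : suc d + suc d' ≡ suc (d + d' + 1)
  eq rewrite +-suc d d' | +-comm (d + d') 1 = refl

_∔_ : Mark → Mark → Mark
mark w d p ∔ mark w' d' q = mark (w + w') (d + d' + 1) (dotLemma p q)

nearLemma : ∀ {w d w' d'} → suc d ≤ w → suc d' ≤ w' → suc (d + d') ≤ w + w' ∸ 1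
nearLemma {suc a} {d} {w'} {d'} (s≤s p) q =
  subst (_≤ a + w') (+-suc d d') (+-mono-≤ p q)

nearMark : Mark → Mark → Mark
nearMark (mark w d p) (mark w' d' q) = mark (w + w' ∸ 1) (d + d') (nearLemma p q)

unitMark : Mark
unitMark = mark 1 0 (s≤s z≤n)

record Graph (V E : ℕ) : Set where
  constructor graph
  field
    marks : Fin V → Mark
    ends  : Fin E → Fin V × Fin V

open Graph public

NonLoop : ∀ {V E} → Graph V E → Fin E → Set
NonLoop G e = proj₁ (ends G e) ≢ proj₂ (ends G e)

delete : ∀ {V E} → Graph V (suc E) → Fin (suc E) → Graph V E
delete G e = graph (marks G) (λ j → ends G (punchIn e j))

-- merging map for the contraction of u v (u ≢ v): v is removed,
-- every other vertex x is sent to  punchOut x  (removing v);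
-- the merged vertex v_e is the image of u.
module _ {V : ℕ} {u v : Fin (suc V)} (u≢v : u ≢ v) where

  v≢u : v ≢ u
  v≢u eq = u≢v (sym eq)

  mergeV : Fin (suc V) → Fin V
  mergeV x with x ≟ v
  ... | yes _  = punchOut v≢u
  ... | no x≢v = punchOut {i = v} {j = x} (λ eq → x≢v (sym eq))

  ve : Fin V
  ve = punchOut v≢u

  -- marks of G/e: the vertex y of G/e is the vertex  punchIn v y  of G
  contractMarks : (Fin (suc V) → Mark) → Fin V → Mark
  contractMarks m y with punchIn v y ≟ u
  ... | yes _ = m u ∔ m v
  ... | no _  = m (punchIn v y)

  nearMarks : (Fin (suc V) → Mark) → Fin V → Mark
  nearMarks m y with punchIn v y ≟ u
  ... | yes _ = nearMark (m u) (m v)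
  ... | no _  = m (punchIn v y)

mapPair : ∀ {A B : Set} → (A → B) → A × A → B × B
mapPair f (a , b) = f a , f b

contract : ∀ {V E} (G : Graph (suc V) (suc E)) (e : Fin (suc E)) → NonLoop G e → Graph V E
contract G e nl =
  graph (contractMarks nl (marks G))
        (λ j → mapPair (mergeV nl) (ends G (punchIn e j)))

-- near-contraction  (G,m) ⊙ e : G/e plus a new vertex v' (= zero) of
-- mark (1,0) and a new edge ℓ_e = v' v_e (= edge zero); v_e gets the
-- mark (w_u + w_v - 1, d_u + d_v).
nearContract : ∀ {V E} (G : Graph (suc V) (suc E)) (e : Fin (suc E)) → NonLoop G e → Graph (suc V) (suc E)
nearContract G e nl =
  graph ms es
  where
  ms : Fin (suc _) → Mark
  ms zero    = unitMark
  ms (suc y) = nearMarks nl (marks G) y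
  es : Fin (suc _) → Fin (suc _) × Fin (suc _)
  es zero    = zero , suc (ve nl)
  es (suc j) = mapPair suc (mapPair (mergeV nl) (ends G (punchIn e j)))

ℓ : ∀ {E} → Fin (suc E)
ℓ = zero

-- The M-polynomial, evaluated at  y, z_{w,d}  in an arbitrary commutative
-- ring R (identity of integer polynomials = identity under all such
-- evaluations).

module MPoly {c ℓ′ : Level} (R : CommutativeRing c ℓ′)
             (y : CommutativeRing.Carrier R)
             (z : ℕ → ℕ → CommutativeRing.Carrier R) where
  open CommutativeRing R using (Carrier; 1#) renaming (_+_ to _⊕_; _*_ to _⊛_)

  prodFin : (n : ℕ) → (Fin n → Carrier) → Carrier
  prodFin zero    f = 1#
  prodFin (suc n) f = f zero ⊛ prodFin n (λ i → f (suc i))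

  M : ∀ {V E} → Graph V E → Carrier
  M {V} {zero} G = prodFin V (λ x → z (w (marks G x)) (d (marks G x)))
  M {zero} {suc E} G with proj₁ (ends G zero)
  ... | ()
  M {suc V} {suc E} G with proj₁ (ends G zero) ≟ proj₂ (ends G zero)
  ... | yes _  = y ⊛ M (delete G zero)
  ... | no nl  = M (delete G zero) ⊕ M (contract G zero nl)

{-# OPTIONS --safe #-}
-- M is invariant under relabelling vertices, and deletion–contraction, which the
-- definition of M performs only at the first edge, holds at every edge by induction on
-- the number of edges. The induction step needs that contracting two distinct edges in
-- either order gives isomorphic graphs: both are quotients of G by maps with the same
-- kernel, and a contracted vertex carries the ∔-sum of the marks it absorbed, which is
-- recorded faithfully by the additive quantities w and d + 1. In (G,m) ⊙ e the edge ℓ_e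
-- is not a loop and contracting it gives back G/e, because (1,0) ∔ (w_u + w_v − 1, d_u + d_v)
-- equals (w_u , d_u) ∔ (w_v , d_v); so M((G,m) ⊙ e) = M(((G,m) ⊙ e) ∖ ℓ_e) + M(G/e).
module Submission where

open import Defs
open import Level using (Level)
open import Data.Nat using (ℕ; suc)
open import Data.Fin using (Fin)
open import Data.Product using (_×_)
open import Algebra.Bundles using (CommutativeRing)

module FibreSums where

  open import Data.Nat using (_+_)
  open import Data.Nat.Properties using (+-0-commutativeMonoid; +-identityʳ; 1+n≰n)
  open import Data.Fin using (punchIn; punchOut)
  open import Data.Fin.Properties using (_≟_; punchInᵢ≢i; punchOut-injective; any?; injective⇒≤)
  open import Data.Product using (_,_; proj₁; proj₂; ∃)
  open import Data.Fin.Permutation using (Permutation; permutation)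
  open import Data.Empty using (⊥-elim)
  open import Function using (_∘_; _⇔_; Equivalence)
  open import Function.Definitions using (Injective)
  open import Relation.Nullary using (yes; no)
  open import Relation.Binary.PropositionalEquality using (_≡_; _≢_; refl; sym; trans; cong; module ≡-Reasoning)
  import Algebra.Properties.CommutativeMonoid.Sum as CommutativeMonoidSum
  open Equivalence using (to; from)
  open CommutativeMonoidSum +-0-commutativeMonoid using (sum; sum-cong-≗; sum-remove; sum-replicate-zero; ∑-comm)

  injective⇒surjective : ∀ {n} {σ : Fin n → Fin n} → Injective _≡_ _≡_ σ → ∀ j → ∃ λ i → σ i ≡ j
  injective⇒surjective {suc n} {σ} σ-injective j with any? (λ i → σ i ≟ j)
  ... | yes hit = hit
  ... | no miss = ⊥-elim (1+n≰n (injective⇒≤ {f = squeeze} squeeze-injective))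
    where
    squeeze : Fin (suc n) → Fin n
    squeeze i = punchOut {i = j} {j = σ i} (λ j≡σi → miss (i , sym j≡σi))
    squeeze-injective : Injective _≡_ _≡_ squeeze
    squeeze-injective eq = σ-injective (punchOut-injective {i = j} _ _ eq)

  injective⇒permutation : ∀ {n} (σ : Fin n → Fin n) → Injective _≡_ _≡_ σ → Permutation n n
  injective⇒permutation σ σ-injective =
    permutation σ (proj₁ ∘ preimage) (proj₂ ∘ preimage) (λ x → σ-injective (proj₂ (preimage (σ x))))
    where
    preimage = injective⇒surjective σ-injective

  sum-vanishing : ∀ {n} (t : Fin n → ℕ) → (∀ i → t i ≡ 0) → sum t ≡ 0
  sum-vanishing {n} t t≡0 = trans (sum-cong-≗ t≡0) (sum-replicate-zero n)

  sum-supportedAt : ∀ {n} (t : Fin n → ℕ) i → (∀ j → j ≢ i → t j ≡ 0) → sum t ≡ t i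
  sum-supportedAt {suc n} t i vanish = begin
    sum t                              ≡⟨ sum-remove {i = i} t ⟩
    t i + sum (λ j → t (punchIn i j))  ≡⟨ cong (t i +_) (sum-vanishing _ (λ j → vanish _ (punchInᵢ≢i i j))) ⟩
    t i + 0                            ≡⟨ +-identityʳ (t i) ⟩
    t i                                ∎
    where open ≡-Reasoning

  restrictTo : ∀ {n m} → (Fin n → Fin m) → Fin m → (Fin n → ℕ) → Fin n → ℕ
  restrictTo Q y f x with Q x ≟ y
  ... | yes _ = f x
  ... | no _  = 0

  fibreSum : ∀ {n m} → (Fin n → Fin m) → Fin m → (Fin n → ℕ) → ℕ
  fibreSum Q y f = sum (restrictTo Q y f)

  restrictTo-in : ∀ {n m} (Q : Fin n → Fin m) f {y} x → Q x ≡ y → restrictTo Q y f x ≡ f x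
  restrictTo-in Q f {y} x Qx≡y with Q x ≟ y
  ... | yes _    = refl
  ... | no Qx≢y = ⊥-elim (Qx≢y Qx≡y)

  restrictTo-out : ∀ {n m} (Q : Fin n → Fin m) f {y} x → Q x ≢ y → restrictTo Q y f x ≡ 0
  restrictTo-out Q f {y} x Qx≢y with Q x ≟ y
  ... | yes Qx≡y = ⊥-elim (Qx≢y Qx≡y)
  ... | no _     = refl

  fibreSum-cong : ∀ {n m} (Q : Fin n → Fin m) {y f g} → (∀ x → f x ≡ g x) → fibreSum Q y f ≡ fibreSum Q y g
  fibreSum-cong Q {y} f≗g = sum-cong-≗ restrictTo-cong
    where
    restrictTo-cong : ∀ x → restrictTo Q y _ x ≡ restrictTo Q y _ x
    restrictTo-cong x with Q x ≟ y
    ... | yes _ = f≗g x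
    ... | no _  = refl

  fibreSum-sameFibre : ∀ {n m m′} (Q : Fin n → Fin m) (Q′ : Fin n → Fin m′) {y y′} f →
                       (∀ {x} → Q x ≡ y ⇔ Q′ x ≡ y′) → fibreSum Q y f ≡ fibreSum Q′ y′ f
  fibreSum-sameFibre Q Q′ {y} {y′} f sameFibre = sum-cong-≗ restrictTo-same
    where
    restrictTo-same : ∀ x → restrictTo Q y f x ≡ restrictTo Q′ y′ f x
    restrictTo-same x with Q x ≟ y | Q′ x ≟ y′
    ... | yes _  | yes _  = refl
    ... | yes hit | no miss = ⊥-elim (miss (to sameFibre hit))
    ... | no miss | yes hit = ⊥-elim (miss (from sameFibre hit))
    ... | no _   | no _   = refl

  fibreSum-injective : ∀ {n m} {Q : Fin n → Fin m} → Injective _≡_ _≡_ Q → ∀ x f → fibreSum Q (Q x) f ≡ f x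
  fibreSum-injective {Q = Q} Q-injective x f =
    trans (sum-supportedAt _ x (λ x′ x′≢x → restrictTo-out Q f x′ (x′≢x ∘ Q-injective)))
          (restrictTo-in Q f x refl)

  fibreSum-∘ : ∀ {n m k} (Q₁ : Fin n → Fin m) (Q₂ : Fin m → Fin k) y f →
               fibreSum Q₂ y (λ y′ → fibreSum Q₁ y′ f) ≡ fibreSum (Q₂ ∘ Q₁) y f
  fibreSum-∘ {n} Q₁ Q₂ y f = begin
    sum (restrictTo Q₂ y (λ y′ → sum (restrictTo Q₁ y′ f)))  ≡⟨ sum-cong-≗ restrictTo-sum ⟩
    sum (λ y′ → sum (λ x → through y′ x))                   ≡⟨ ∑-comm through ⟩
    sum (λ x → sum (λ y′ → through y′ x))                   ≡⟨ sum-cong-≗ (λ x → sum-supportedAt _ (Q₁ x) (off-image x)) ⟩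
    sum (λ x → through (Q₁ x) x)                             ≡⟨ sum-cong-≗ on-image ⟩
    sum (restrictTo (Q₂ ∘ Q₁) y f)                           ∎
    where
    open ≡-Reasoning
    through : Fin _ → Fin _ → ℕ
    through y′ x = restrictTo Q₂ y (λ y″ → restrictTo Q₁ y″ f x) y′
    restrictTo-sum : ∀ y′ → restrictTo Q₂ y (λ y″ → sum (restrictTo Q₁ y″ f)) y′ ≡ sum (λ x → through y′ x)
    restrictTo-sum y′ with Q₂ y′ ≟ y
    ... | yes _ = refl
    ... | no _  = sym (sum-vanishing {n} _ (λ _ → refl))
    off-image : ∀ x y′ → y′ ≢ Q₁ x → through y′ x ≡ 0
    off-image x y′ y′≢Q₁x with Q₂ y′ ≟ y
    ... | yes _ = restrictTo-out Q₁ f x (y′≢Q₁x ∘ sym)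
    ... | no _  = refl
    on-image : ∀ x → through (Q₁ x) x ≡ restrictTo (Q₂ ∘ Q₁) y f x
    on-image x with Q₂ (Q₁ x) ≟ y
    ... | yes _ = restrictTo-in Q₁ f x refl
    ... | no _  = refl

module Contraction where

  open import Data.Nat using (_+_; s≤s)
  open import Data.Nat.Properties using (+-0-commutativeMonoid; +-comm; +-assoc; ≤-irrelevant; suc-injective)
  open import Algebra.Properties.CommutativeMonoid.Sum +-0-commutativeMonoid using (sum; sum-remove)
  open import Data.Fin using (zero; suc; punchIn)
  open import Data.Fin.Properties using (_≟_; 0≢1+n; punchInᵢ≢i; punchIn-injective; punchIn-punchOut; punchOut-cong; punchOut-punchIn)
    renaming (suc-injective to Fin-suc-injective)
  open import Data.Product using (_,_; proj₁; proj₂) renaming (map to ×-map)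
  open import Data.Sum using (_⊎_; inj₁; inj₂) renaming (map to ⊎-map)
  open import Data.Empty using (⊥-elim)
  open import Function using (id; _∘_; _⇔_; mk⇔; Equivalence)
  open import Function.Definitions using (Injective)
  open import Function.Properties.Equivalence using (⇔-setoid)
  open import Function.Construct.Symmetry using (⇔-sym)
  open import Relation.Nullary using (Dec; yes; no)
  open import Relation.Binary.PropositionalEquality using (_≡_; _≢_; refl; sym; trans; cong; cong₂; module ≡-Reasoning)
  import Relation.Binary.Reasoning.Setoid as SetoidReasoning
  open Equivalence using (to; from)
  open FibreSums

  module ⇔-Reasoning = SetoidReasoning (⇔-setoid Level.zero)

  Loop : ∀ {V E} → Graph V E → Fin E → Set
  Loop G e = proj₁ (ends G e) ≡ proj₂ (ends G e)

  loop? : ∀ {V E} (G : Graph V E) e → Dec (Loop G e)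
  loop? G e = proj₁ (ends G e) ≟ proj₂ (ends G e)

  Fin1-≡ : (i j : Fin 1) → i ≡ j
  Fin1-≡ zero zero = refl

  mark-≡ : ∀ {a b : Mark} → w a ≡ w b → d a ≡ d b → a ≡ b
  mark-≡ {mark _ _ p} {mark _ _ q} refl refl = cong (mark _ _) (≤-irrelevant p q)

  suc-d-∔ : ∀ a b → suc (d (a ∔ b)) ≡ suc (d a) + suc (d b)
  suc-d-∔ a b = cong suc (trans (+-assoc (d a) (d b) 1) (cong (d a +_) (+-comm (d b) 1)))

  unitMark∔nearMark : ∀ a b → unitMark ∔ nearMark a b ≡ a ∔ b
  unitMark∔nearMark (mark (suc _) _ (s≤s _)) _ = mark-≡ refl refl

  OneOf : ∀ {n} → Fin n → Fin n → Fin n → Set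
  OneOf u v x = x ≡ u ⊎ x ≡ v

  Identified : ∀ {n} → Fin n → Fin n → Fin n → Fin n → Set
  Identified u v a b = a ≡ b ⊎ (OneOf u v a × OneOf u v b)

  identified-relabel : ∀ {n m} {σ : Fin n → Fin m} → Injective _≡_ _≡_ σ →
                       ∀ {u v a b} → Identified u v a b ⇔ Identified (σ u) (σ v) (σ a) (σ b)
  identified-relabel {σ = σ} σ-injective =
    mk⇔ (⊎-map (cong σ) (×-map (⊎-map (cong σ) (cong σ)) (⊎-map (cong σ) (cong σ))))
        (⊎-map σ-injective (×-map (⊎-map σ-injective σ-injective) (⊎-map σ-injective σ-injective)))

  identified-mono : ∀ {n} {u₀ v₀ u₁ v₁ a b : Fin n} → OneOf u₁ v₁ u₀ → OneOf u₁ v₁ v₀ →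
                    Identified u₀ v₀ a b → Identified u₁ v₁ a b
  identified-mono {u₀ = u₀} {v₀} {u₁} {v₁} u₀∈ v₀∈ = ⊎-map id (×-map widen widen)
    where
    widen : ∀ {x} → OneOf u₀ v₀ x → OneOf u₁ v₁ x
    widen (inj₁ refl) = u₀∈
    widen (inj₂ refl) = v₀∈

  oneOf-swap : ∀ {n} {u₀ v₀ u₁ v₁ : Fin n} → u₁ ≢ v₁ → OneOf u₀ v₀ u₁ → OneOf u₀ v₀ v₁ →
               OneOf u₁ v₁ u₀ × OneOf u₁ v₁ v₀
  oneOf-swap u₁≢v₁ (inj₁ refl) (inj₁ refl) = ⊥-elim (u₁≢v₁ refl)
  oneOf-swap u₁≢v₁ (inj₁ refl) (inj₂ refl) = inj₁ refl , inj₂ refl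
  oneOf-swap u₁≢v₁ (inj₂ refl) (inj₁ refl) = inj₂ refl , inj₁ refl
  oneOf-swap u₁≢v₁ (inj₂ refl) (inj₂ refl) = ⊥-elim (u₁≢v₁ refl)

  module _ {V} {u v : Fin (suc V)} (u≢v : u ≢ v) where

    punchIn-ve : punchIn v (ve u≢v) ≡ u
    punchIn-ve = punchIn-punchOut (v≢u u≢v)

    punchIn≡u⇒≡ve : ∀ {y} → punchIn v y ≡ u → y ≡ ve u≢v
    punchIn≡u⇒≡ve eq = punchIn-injective v _ _ (trans eq (sym punchIn-ve))

    mergeV-punchIn : ∀ y → mergeV u≢v (punchIn v y) ≡ y
    mergeV-punchIn y with punchIn v y ≟ v
    ... | yes eq = ⊥-elim (punchInᵢ≢i v y eq)
    ... | no _   = trans (punchOut-cong v refl) (punchOut-punchIn v)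

    mergeV-v : mergeV u≢v v ≡ ve u≢v
    mergeV-v with v ≟ v
    ... | yes _   = refl
    ... | no v≢v = ⊥-elim (v≢v refl)

    mergeV-u : mergeV u≢v u ≡ ve u≢v
    mergeV-u with u ≟ v
    ... | yes u≡v = ⊥-elim (u≢v u≡v)
    ... | no _    = punchOut-cong v refl

    punchIn-mergeV-≡v : ∀ {x} → x ≡ v → punchIn v (mergeV u≢v x) ≡ u
    punchIn-mergeV-≡v refl = trans (cong (punchIn v) mergeV-v) punchIn-ve

    punchIn-mergeV-≢v : ∀ {x} → x ≢ v → punchIn v (mergeV u≢v x) ≡ x
    punchIn-mergeV-≢v {x} x≢v with x ≟ v
    ... | yes x≡v = ⊥-elim (x≢v x≡v)
    ... | no _    = punchIn-punchOut _

    mergeV-kernel : ∀ {a b} → mergeV u≢v a ≡ mergeV u≢v b ⇔ Identified u v a b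
    mergeV-kernel {a} {b} = mk⇔ (λ eq → identify (a ≟ v) (b ≟ v) (cong (punchIn v) eq)) merge
      where
      identify : ∀ {a b} → Dec (a ≡ v) → Dec (b ≡ v) →
                 punchIn v (mergeV u≢v a) ≡ punchIn v (mergeV u≢v b) → Identified u v a b
      identify (yes a≡v) (yes b≡v) _  = inj₁ (trans a≡v (sym b≡v))
      identify (yes a≡v) (no b≢v)  eq =
        inj₂ (inj₂ a≡v , inj₁ (trans (sym (punchIn-mergeV-≢v b≢v)) (trans (sym eq) (punchIn-mergeV-≡v a≡v))))
      identify (no a≢v)  (yes b≡v) eq =
        inj₂ (inj₁ (trans (sym (punchIn-mergeV-≢v a≢v)) (trans eq (punchIn-mergeV-≡v b≡v))) , inj₂ b≡v)
      identify (no a≢v)  (no b≢v)  eq =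
        inj₁ (trans (sym (punchIn-mergeV-≢v a≢v)) (trans eq (punchIn-mergeV-≢v b≢v)))
      oneOf-ve : ∀ {x} → OneOf u v x → mergeV u≢v x ≡ ve u≢v
      oneOf-ve (inj₁ refl) = mergeV-u
      oneOf-ve (inj₂ refl) = mergeV-v
      merge : ∀ {a b} → Identified u v a b → mergeV u≢v a ≡ mergeV u≢v b
      merge (inj₁ refl)        = refl
      merge (inj₂ (a∈ , b∈)) = trans (oneOf-ve a∈) (sym (oneOf-ve b∈))

    fibreSum-mergeV : ∀ y f → fibreSum (mergeV u≢v) y f ≡ restrictTo (mergeV u≢v) y f v + f (punchIn v y)
    fibreSum-mergeV y f = trans (sum-remove {i = v} (restrictTo (mergeV u≢v) y f)) (cong (restrictTo (mergeV u≢v) y f v +_) off-v)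
      where
      off-v : sum (λ j → restrictTo (mergeV u≢v) y f (punchIn v j)) ≡ f (punchIn v y)
      off-v = trans (sum-supportedAt _ y (λ j j≢y → restrictTo-out (mergeV u≢v) f (punchIn v j) (λ eq → j≢y (trans (sym (mergeV-punchIn j)) eq))))
                    (restrictTo-in (mergeV u≢v) f (punchIn v y) (mergeV-punchIn y))

    fibreSum-mergeV-merged : ∀ {y} f → punchIn v y ≡ u → fibreSum (mergeV u≢v) y f ≡ f u + f v
    fibreSum-mergeV-merged {y} f merged = begin
      fibreSum (mergeV u≢v) y f                            ≡⟨ fibreSum-mergeV y f ⟩
      restrictTo (mergeV u≢v) y f v + f (punchIn v y)  ≡⟨ cong₂ _+_ (restrictTo-in (mergeV u≢v) f v (trans mergeV-v (sym (punchIn≡u⇒≡ve merged)))) (cong f merged) ⟩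
      f v + f u                                            ≡⟨ +-comm (f v) (f u) ⟩
      f u + f v                                            ∎
      where open ≡-Reasoning

    fibreSum-mergeV-other : ∀ {y} f → punchIn v y ≢ u → fibreSum (mergeV u≢v) y f ≡ f (punchIn v y)
    fibreSum-mergeV-other {y} f other =
      trans (fibreSum-mergeV y f)
            (cong (_+ f (punchIn v y)) (restrictTo-out (mergeV u≢v) f v (λ eq → other (trans (cong (punchIn v) (sym eq)) (punchIn-mergeV-≡v refl)))))

    w-contractMarks : ∀ m y → w (contractMarks u≢v m y) ≡ fibreSum (mergeV u≢v) y (w ∘ m)
    w-contractMarks m y with punchIn v y ≟ u
    ... | yes merged = sym (fibreSum-mergeV-merged (w ∘ m) merged)
    ... | no other   = sym (fibreSum-mergeV-other (w ∘ m) other)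

    suc-d-contractMarks : ∀ m y → suc (d (contractMarks u≢v m y)) ≡ fibreSum (mergeV u≢v) y (suc ∘ d ∘ m)
    suc-d-contractMarks m y with punchIn v y ≟ u
    ... | yes merged = trans (suc-d-∔ (m u) (m v)) (sym (fibreSum-mergeV-merged (suc ∘ d ∘ m) merged))
    ... | no other   = sym (fibreSum-mergeV-other (suc ∘ d ∘ m) other)

    contractMarks-merged : ∀ m {y} → punchIn v y ≡ u → contractMarks u≢v m y ≡ m u ∔ m v
    contractMarks-merged m {y} merged with punchIn v y ≟ u
    ... | yes _     = refl
    ... | no other = ⊥-elim (other merged)

    contractMarks-other : ∀ m {y} → punchIn v y ≢ u → contractMarks u≢v m y ≡ m (punchIn v y)
    contractMarks-other m {y} other with punchIn v y ≟ u
    ... | yes merged = ⊥-elim (other merged)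
    ... | no _       = refl

    nearMarks-merged : ∀ m {y} → punchIn v y ≡ u → nearMarks u≢v m y ≡ nearMark (m u) (m v)
    nearMarks-merged m {y} merged with punchIn v y ≟ u
    ... | yes _     = refl
    ... | no other = ⊥-elim (other merged)

    nearMarks-other : ∀ m {y} → punchIn v y ≢ u → nearMarks u≢v m y ≡ m (punchIn v y)
    nearMarks-other m {y} other with punchIn v y ≟ u
    ... | yes merged = ⊥-elim (other merged)
    ... | no _       = refl

  record _≅_ {V E} (G H : Graph V E) : Set where
    field
      relabel           : Fin V → Fin V
      relabel-injective : Injective _≡_ _≡_ relabel
      marks-relabel     : ∀ x → marks H (relabel x) ≡ marks G x
      ends-relabel      : ∀ j → ends H j ≡ mapPair relabel (ends G j)

  open _≅_

  ≅-refl : ∀ {V E} {G : Graph V E} → G ≅ G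
  ≅-refl = record { relabel = id ; relabel-injective = id ; marks-relabel = λ _ → refl ; ends-relabel = λ _ → refl }

  ≅-delete : ∀ {V E} {G H : Graph V (suc E)} → G ≅ H → ∀ e → delete G e ≅ delete H e
  ≅-delete i e = record
    { relabel = relabel i ; relabel-injective = relabel-injective i
    ; marks-relabel = marks-relabel i ; ends-relabel = ends-relabel i ∘ punchIn e }

  ≅-preservesLoop : ∀ {V E} {G H : Graph V E} → G ≅ H → ∀ e → Loop G e ⇔ Loop H e
  ≅-preservesLoop i e = mk⇔
    (λ loop → trans (cong proj₁ (ends-relabel i e)) (trans (cong (relabel i) loop) (sym (cong proj₂ (ends-relabel i e)))))
    (λ loop → relabel-injective i (trans (sym (cong proj₁ (ends-relabel i e))) (trans loop (cong proj₂ (ends-relabel i e)))))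

  -- H arises from a graph with marks m and edges ends′ by merging the fibres of Q; a
  -- merged vertex carries the ∔-sum of the marks in its fibre, which is determined by
  -- the additive quantities w and d + 1.
  record IsQuotient {n V E} (Q : Fin n → Fin V) (m : Fin n → Mark) (ends′ : Fin E → Fin n × Fin n)
                    (H : Graph V E) : Set where
    field
      w-marks     : ∀ y → w (marks H y) ≡ fibreSum Q y (w ∘ m)
      suc-d-marks : ∀ y → suc (d (marks H y)) ≡ fibreSum Q y (suc ∘ d ∘ m)
      ends-image  : ∀ j → ends H j ≡ mapPair Q (ends′ j)

  open IsQuotient

  ≅⇒isQuotient : ∀ {V E} {G H : Graph V E} (i : G ≅ H) → IsQuotient (relabel i) (marks G) (ends G) H
  ≅⇒isQuotient {G = G} {H} i = record
    { w-marks = atRelabel w ; suc-d-marks = atRelabel (suc ∘ d) ; ends-image = ends-relabel i }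
    where
    atRelabel : ∀ (g : Mark → ℕ) y → g (marks H y) ≡ fibreSum (relabel i) y (g ∘ marks G)
    atRelabel g y with injective⇒surjective (relabel-injective i) y
    ... | x , refl = trans (cong g (marks-relabel i x)) (sym (fibreSum-injective (relabel-injective i) x (g ∘ marks G)))

  isQuotient-self : ∀ {V E} (G : Graph V E) → IsQuotient id (marks G) (ends G) G
  isQuotient-self G = ≅⇒isQuotient (≅-refl {G = G})

  isQuotient-delete : ∀ {n V E} {Q : Fin n → Fin V} {m ends′} {G : Graph V (suc E)} →
                      IsQuotient Q m ends′ G → ∀ e → IsQuotient Q m (ends′ ∘ punchIn e) (delete G e)
  isQuotient-delete q e = record
    { w-marks = w-marks q ; suc-d-marks = suc-d-marks q ; ends-image = ends-image q ∘ punchIn e }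

  isQuotient-contract : ∀ {n V E} {Q : Fin n → Fin (suc V)} {m ends′} {G : Graph (suc V) (suc E)} →
                        IsQuotient Q m ends′ G → ∀ e (nl : NonLoop G e) →
                        IsQuotient (mergeV nl ∘ Q) m (ends′ ∘ punchIn e) (contract G e nl)
  isQuotient-contract {Q = Q} {m} {G = G} q e nl = record
    { w-marks     = λ y → trans (w-contractMarks nl (marks G) y) (mergeFibres w (w-marks q) y)
    ; suc-d-marks = λ y → trans (suc-d-contractMarks nl (marks G) y) (mergeFibres (suc ∘ d) (suc-d-marks q) y)
    ; ends-image  = λ j → cong (mapPair (mergeV nl)) (ends-image q (punchIn e j)) }
    where
    mergeFibres : ∀ (g : Mark → ℕ) → (∀ x → g (marks G x) ≡ fibreSum Q x (g ∘ m)) →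
                  ∀ y → fibreSum (mergeV nl) y (g ∘ marks G) ≡ fibreSum (mergeV nl ∘ Q) y (g ∘ m)
    mergeFibres g g-marks y = trans (fibreSum-cong (mergeV nl) g-marks) (fibreSum-∘ Q (mergeV nl) y (g ∘ m))

  isQuotient⇒≅ : ∀ {n V E} {Q₁ Q₂ : Fin n → Fin V} {m ends′} {H₁ H₂ : Graph V E} →
                 IsQuotient Q₁ m ends′ H₁ → IsQuotient Q₂ m ends′ H₂ →
                 (s : Fin V → Fin n) → (∀ y → Q₁ (s y) ≡ y) →
                 (∀ {a b} → Q₁ a ≡ Q₁ b ⇔ Q₂ a ≡ Q₂ b) → H₁ ≅ H₂
  isQuotient⇒≅ {Q₁ = Q₁} {Q₂} {m} {ends′} q₁ q₂ s Q₁∘s≗id sameKernel = record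
    { relabel           = relabel′
    ; relabel-injective = λ {a} {b} eq → trans (sym (Q₁∘s≗id a)) (trans (from sameKernel eq) (Q₁∘s≗id b))
    ; marks-relabel     = λ y → mark-≡ (sameFibreSum (w-marks q₁) (w-marks q₂) y)
                                        (suc-injective (sameFibreSum (suc-d-marks q₁) (suc-d-marks q₂) y))
    ; ends-relabel      = λ j → trans (ends-image q₂ j)
                                  (trans (sym (cong₂ _,_ (relabel∘Q₁ (proj₁ (ends′ j))) (relabel∘Q₁ (proj₂ (ends′ j)))))
                                         (cong (mapPair relabel′) (sym (ends-image q₁ j)))) }
    where
    relabel′ : Fin _ → Fin _
    relabel′ y = Q₂ (s y)
    relabel∘Q₁ : ∀ x → relabel′ (Q₁ x) ≡ Q₂ x
    relabel∘Q₁ x = to sameKernel (Q₁∘s≗id (Q₁ x))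
    fibre : ∀ {y x} → Q₂ x ≡ relabel′ y ⇔ Q₁ x ≡ y
    fibre {y} = mk⇔ (λ eq → trans (from sameKernel eq) (Q₁∘s≗id y)) (λ eq → to sameKernel (trans eq (sym (Q₁∘s≗id y))))
    sameFibreSum : ∀ {g : Fin _ → ℕ} {h₁ h₂ : Fin _ → ℕ} →
                   (∀ y → h₁ y ≡ fibreSum Q₁ y g) → (∀ y → h₂ y ≡ fibreSum Q₂ y g) → ∀ y → h₂ (relabel′ y) ≡ h₁ y
    sameFibreSum {g} h₁≡ h₂≡ y = trans (h₂≡ (relabel′ y)) (trans (fibreSum-sameFibre Q₂ Q₁ g fibre) (sym (h₁≡ y)))

  ≅-contract : ∀ {V E} {G H : Graph (suc V) (suc E)} (i : G ≅ H) e (nlG : NonLoop G e) (nlH : NonLoop H e) →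
               contract G e nlG ≅ contract H e nlH
  ≅-contract {G = G} {H} i e nlG nlH =
    isQuotient⇒≅ (isQuotient-contract (isQuotient-self G) e nlG) (isQuotient-contract (≅⇒isQuotient i) e nlH)
                 (punchIn (proj₂ (ends G e))) (mergeV-punchIn nlG) sameKernel
    where
    open ⇔-Reasoning
    σ = relabel i
    sameKernel : ∀ {a b} → mergeV nlG a ≡ mergeV nlG b ⇔ mergeV nlH (σ a) ≡ mergeV nlH (σ b)
    sameKernel {a} {b} = begin
      mergeV nlG a ≡ mergeV nlG b                                            ≈⟨ mergeV-kernel nlG ⟩
      Identified (proj₁ (ends G e)) (proj₂ (ends G e)) a b                   ≈⟨ identified-relabel (relabel-injective i) ⟩
      Identified (σ (proj₁ (ends G e))) (σ (proj₂ (ends G e))) (σ a) (σ b)  ≡⟨ cong₂ (λ u v → Identified u v (σ a) (σ b))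
                                                                                    (cong proj₁ (sym (ends-relabel i e)))
                                                                                    (cong proj₂ (sym (ends-relabel i e))) ⟩
      Identified (proj₁ (ends H e)) (proj₂ (ends H e)) (σ a) (σ b)           ≈⟨ ⇔-sym (mergeV-kernel nlH) ⟩
      mergeV nlH (σ a) ≡ mergeV nlH (σ b)                                    ∎

  mergeV-loop⇒parallel : ∀ {V} {u₀ v₀ u₁ v₁ : Fin (suc V)} (u₀≢v₀ : u₀ ≢ v₀) → u₁ ≢ v₁ →
                         mergeV u₀≢v₀ u₁ ≡ mergeV u₀≢v₀ v₁ → OneOf u₀ v₀ u₁ × OneOf u₀ v₀ v₁
  mergeV-loop⇒parallel u₀≢v₀ u₁≢v₁ loop with to (mergeV-kernel u₀≢v₀) loop
  ... | inj₁ u₁≡v₁ = ⊥-elim (u₁≢v₁ u₁≡v₁)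
  ... | inj₂ ends₁ = ends₁

  mergeV-loop-swap : ∀ {V} {u₀ v₀ u₁ v₁ : Fin (suc V)} (u₀≢v₀ : u₀ ≢ v₀) (u₁≢v₁ : u₁ ≢ v₁) →
                     mergeV u₀≢v₀ u₁ ≡ mergeV u₀≢v₀ v₁ → mergeV u₁≢v₁ u₀ ≡ mergeV u₁≢v₁ v₀
  mergeV-loop-swap u₀≢v₀ u₁≢v₁ loop =
    let (u₁∈ , v₁∈) = mergeV-loop⇒parallel u₀≢v₀ u₁≢v₁ loop
    in from (mergeV-kernel u₁≢v₁) (inj₂ (oneOf-swap u₁≢v₁ u₁∈ v₁∈))

  contract-parallel-≅ : ∀ {V E} (G : Graph (suc (suc V)) (suc (suc E))) e
                          (nl₀ : NonLoop G zero) (nl₁ : NonLoop G (suc e)) → Loop (contract G zero nl₀) e →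
                        contract (delete G zero) e nl₁ ≅ delete (contract G zero nl₀) e
  contract-parallel-≅ G e nl₀ nl₁ loop =
    isQuotient⇒≅ (isQuotient-contract (isQuotient-delete (isQuotient-self G) zero) e nl₁)
                 (isQuotient-delete (isQuotient-contract (isQuotient-self G) zero nl₀) e)
                 (punchIn (proj₂ (ends G (suc e)))) (mergeV-punchIn nl₁) (λ {a} {b} → sameKernel {a} {b})
    where
    open ⇔-Reasoning
    ends₁⊆ends₀ = mergeV-loop⇒parallel nl₀ nl₁ loop
    ends₀⊆ends₁ = oneOf-swap nl₁ (proj₁ ends₁⊆ends₀) (proj₂ ends₁⊆ends₀)
    sameKernel : ∀ {a b} → mergeV nl₁ a ≡ mergeV nl₁ b ⇔ mergeV nl₀ a ≡ mergeV nl₀ b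
    sameKernel {a} {b} = begin
      mergeV nl₁ a ≡ mergeV nl₁ b                                  ≈⟨ mergeV-kernel nl₁ ⟩
      Identified (proj₁ (ends G (suc e))) (proj₂ (ends G (suc e))) a b
        ≈⟨ mk⇔ (identified-mono (proj₁ ends₁⊆ends₀) (proj₂ ends₁⊆ends₀)) (identified-mono (proj₁ ends₀⊆ends₁) (proj₂ ends₀⊆ends₁)) ⟩
      Identified (proj₁ (ends G zero)) (proj₂ (ends G zero)) a b   ≈⟨ ⇔-sym (mergeV-kernel nl₀) ⟩
      mergeV nl₀ a ≡ mergeV nl₀ b                                  ∎

  JoinedTo : ∀ {n} → Fin n → Fin n → Fin n → Fin n → Fin n → Set
  JoinedTo u₀ v₀ u₁ v₁ x = Identified u₀ v₀ x u₁ ⊎ Identified u₀ v₀ x v₁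

  -- The kernel of merging u₀ with v₀ and then the images of u₁ and v₁.
  Identified₂ : ∀ {n} → Fin n → Fin n → Fin n → Fin n → Fin n → Fin n → Set
  Identified₂ u₀ v₀ u₁ v₁ a b = Identified u₀ v₀ a b ⊎ (JoinedTo u₀ v₀ u₁ v₁ a × JoinedTo u₀ v₀ u₁ v₁ b)

  mergeV-identified₂ : ∀ {V} {u₀ v₀ : Fin (suc V)} (u₀≢v₀ : u₀ ≢ v₀) {u₁ v₁ a b} →
                       Identified (mergeV u₀≢v₀ u₁) (mergeV u₀≢v₀ v₁) (mergeV u₀≢v₀ a) (mergeV u₀≢v₀ b)
                       ⇔ Identified₂ u₀ v₀ u₁ v₁ a b
  mergeV-identified₂ u₀≢v₀ =
    mk⇔ (⊎-map (to K) (×-map (⊎-map (to K) (to K)) (⊎-map (to K) (to K))))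
        (⊎-map (from K) (×-map (⊎-map (from K) (from K)) (⊎-map (from K) (from K))))
    where
    K = mergeV-kernel u₀≢v₀

  module _ {n} {u₀ v₀ u₁ v₁ : Fin n} where

    EdgesMeet : Set
    EdgesMeet = OneOf u₀ v₀ u₁ ⊎ OneOf u₀ v₀ v₁

    joinedTo-cases : ∀ {x} → JoinedTo u₀ v₀ u₁ v₁ x → OneOf u₁ v₁ x ⊎ (OneOf u₀ v₀ x × EdgesMeet)
    joinedTo-cases (inj₁ (inj₁ refl))           = inj₁ (inj₁ refl)
    joinedTo-cases (inj₁ (inj₂ (x∈ , u₁∈))) = inj₂ (x∈ , inj₁ u₁∈)
    joinedTo-cases (inj₂ (inj₁ refl))           = inj₁ (inj₂ refl)
    joinedTo-cases (inj₂ (inj₂ (x∈ , v₁∈))) = inj₂ (x∈ , inj₂ v₁∈)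

    oneOf⇒joinedTo : ∀ {x} → OneOf u₀ v₀ x → JoinedTo u₁ v₁ u₀ v₀ x
    oneOf⇒joinedTo (inj₁ refl) = inj₁ (inj₁ refl)
    oneOf⇒joinedTo (inj₂ refl) = inj₂ (inj₁ refl)

    edgesMeet⇒joinedTo : ∀ {x} → EdgesMeet → OneOf u₁ v₁ x → JoinedTo u₁ v₁ u₀ v₀ x
    edgesMeet⇒joinedTo (inj₁ (inj₁ refl)) x∈ = inj₁ (inj₂ (x∈ , inj₁ refl))
    edgesMeet⇒joinedTo (inj₁ (inj₂ refl)) x∈ = inj₂ (inj₂ (x∈ , inj₁ refl))
    edgesMeet⇒joinedTo (inj₂ (inj₁ refl)) x∈ = inj₁ (inj₂ (x∈ , inj₂ refl))
    edgesMeet⇒joinedTo (inj₂ (inj₂ refl)) x∈ = inj₂ (inj₂ (x∈ , inj₂ refl))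

    identified₂-swap : ∀ {a b} → Identified₂ u₀ v₀ u₁ v₁ a b → Identified₂ u₁ v₁ u₀ v₀ a b
    identified₂-swap (inj₁ (inj₁ a≡b))          = inj₁ (inj₁ a≡b)
    identified₂-swap (inj₁ (inj₂ (a∈ , b∈))) = inj₂ (oneOf⇒joinedTo a∈ , oneOf⇒joinedTo b∈)
    identified₂-swap (inj₂ (a~ , b~)) with joinedTo-cases a~ | joinedTo-cases b~
    ... | inj₁ a∈          | inj₁ b∈          = inj₁ (inj₂ (a∈ , b∈))
    ... | inj₁ a∈          | inj₂ (b∈ , meet) = inj₂ (edgesMeet⇒joinedTo meet a∈ , oneOf⇒joinedTo b∈)
    ... | inj₂ (a∈ , meet) | inj₁ b∈          = inj₂ (oneOf⇒joinedTo a∈ , edgesMeet⇒joinedTo meet b∈)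
    ... | inj₂ (a∈ , _)    | inj₂ (b∈ , _)    = inj₂ (oneOf⇒joinedTo a∈ , oneOf⇒joinedTo b∈)

  contract-comm-≅ : ∀ {V E} (G : Graph (suc (suc V)) (suc (suc E))) e
                      (nl₀ : NonLoop G zero) (nl₁ : NonLoop G (suc e))
                      (nl₁′ : NonLoop (contract G zero nl₀) e) (nl₀′ : NonLoop (contract G (suc e) nl₁) zero) →
                    contract (contract G zero nl₀) e nl₁′ ≅ contract (contract G (suc e) nl₁) zero nl₀′
  contract-comm-≅ G e nl₀ nl₁ nl₁′ nl₀′ =
    isQuotient⇒≅ (isQuotient-contract (isQuotient-contract (isQuotient-self G) zero nl₀) e nl₁′)
                 (isQuotient-contract (isQuotient-contract (isQuotient-self G) (suc e) nl₁) zero nl₀′)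
                 (punchIn v₀ ∘ punchIn (mergeV nl₀ v₁))
                 (λ y → trans (cong (mergeV nl₁′) (mergeV-punchIn nl₀ _)) (mergeV-punchIn nl₁′ y))
                 (λ {a} {b} → sameKernel {a} {b})
    where
    open ⇔-Reasoning
    u₀ = proj₁ (ends G zero)
    v₀ = proj₂ (ends G zero)
    u₁ = proj₁ (ends G (suc e))
    v₁ = proj₂ (ends G (suc e))
    sameKernel : ∀ {a b} → mergeV nl₁′ (mergeV nl₀ a) ≡ mergeV nl₁′ (mergeV nl₀ b)
                           ⇔ mergeV nl₀′ (mergeV nl₁ a) ≡ mergeV nl₀′ (mergeV nl₁ b)
    sameKernel {a} {b} = begin
      mergeV nl₁′ (mergeV nl₀ a) ≡ mergeV nl₁′ (mergeV nl₀ b)                         ≈⟨ mergeV-kernel nl₁′ ⟩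
      Identified (mergeV nl₀ u₁) (mergeV nl₀ v₁) (mergeV nl₀ a) (mergeV nl₀ b)  ≈⟨ mergeV-identified₂ nl₀ ⟩
      Identified₂ u₀ v₀ u₁ v₁ a b                                                   ≈⟨ mk⇔ identified₂-swap identified₂-swap ⟩
      Identified₂ u₁ v₁ u₀ v₀ a b                                                   ≈⟨ ⇔-sym (mergeV-identified₂ nl₁) ⟩
      Identified (mergeV nl₁ u₀) (mergeV nl₁ v₀) (mergeV nl₁ a) (mergeV nl₁ b)  ≈⟨ ⇔-sym (mergeV-kernel nl₀′) ⟩
      mergeV nl₀′ (mergeV nl₁ a) ≡ mergeV nl₀′ (mergeV nl₁ b)                         ∎

  nearContract-ℓ-nonLoop : ∀ {V E} (G : Graph (suc V) (suc E)) e (nl : NonLoop G e) → NonLoop (nearContract G e nl) ℓ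
  nearContract-ℓ-nonLoop G e nl ()

  contract-nearContract-≅ : ∀ {V E} (G : Graph (suc V) (suc E)) e (nl : NonLoop G e) →
                            contract G e nl ≅ contract (nearContract G e nl) ℓ (nearContract-ℓ-nonLoop G e nl)
  contract-nearContract-≅ {V} G e nl = record
    { relabel = relabel′ ; relabel-injective = injective
    ; marks-relabel = λ y → marks-relabel′ y (y ≟ ve nl) ; ends-relabel = λ _ → refl }
    where
    open ≡-Reasoning
    u = proj₁ (ends G e)
    v = proj₂ (ends G e)
    N = nearContract G e nl
    nlN = nearContract-ℓ-nonLoop G e nl
    relabel′ : Fin V → Fin V
    relabel′ y = mergeV nlN (suc y)
    injective : Injective _≡_ _≡_ relabel′
    injective eq with to (mergeV-kernel nlN) eq
    ... | inj₁ sa≡sb                      = Fin-suc-injective sa≡sb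
    ... | inj₂ (inj₂ sa≡sve , inj₂ sb≡sve) = Fin-suc-injective (trans sa≡sve (sym sb≡sve))
    marks-relabel′ : ∀ y → Dec (y ≡ ve nl) → contractMarks nlN (marks N) (relabel′ y) ≡ contractMarks nl (marks G) y
    marks-relabel′ y (yes refl) = begin
      contractMarks nlN (marks N) (relabel′ (ve nl))  ≡⟨ contractMarks-merged nlN (marks N) (punchIn-mergeV-≡v nlN refl) ⟩
      unitMark ∔ nearMarks nl (marks G) (ve nl)        ≡⟨ cong (unitMark ∔_) (nearMarks-merged nl (marks G) (punchIn-ve nl)) ⟩
      unitMark ∔ nearMark (marks G u) (marks G v)      ≡⟨ unitMark∔nearMark (marks G u) (marks G v) ⟩
      marks G u ∔ marks G v                            ≡⟨ contractMarks-merged nl (marks G) (punchIn-ve nl) ⟨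
      contractMarks nl (marks G) (ve nl)               ∎
    marks-relabel′ y (no y≢ve) = begin
      contractMarks nlN (marks N) (relabel′ y)        ≡⟨ contractMarks-other nlN (marks N) (λ eq → 0≢1+n (trans (sym eq) unmerged)) ⟩
      marks N (punchIn (suc (ve nl)) (relabel′ y))    ≡⟨ cong (marks N) unmerged ⟩
      nearMarks nl (marks G) y                         ≡⟨ nearMarks-other nl (marks G) (y≢ve ∘ punchIn≡u⇒≡ve nl) ⟩
      marks G (punchIn v y)                            ≡⟨ contractMarks-other nl (marks G) (y≢ve ∘ punchIn≡u⇒≡ve nl) ⟨
      contractMarks nl (marks G) y                     ∎
      where
      unmerged : punchIn (suc (ve nl)) (relabel′ y) ≡ suc y
      unmerged = punchIn-mergeV-≢v nlN (y≢ve ∘ Fin-suc-injective)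

module DeletionContraction {c ℓ′ : Level} (R : CommutativeRing c ℓ′)
                           (y : CommutativeRing.Carrier R) (z : ℕ → ℕ → CommutativeRing.Carrier R) where

  open import Data.Nat using (zero)
  open import Data.Fin using (zero; suc)
  open import Data.Fin.Properties using (_≟_)
  open import Data.Product using (proj₁; proj₂)
  open import Data.Empty using (⊥-elim)
  open import Function using (_∘_; Equivalence)
  open import Relation.Nullary using (Dec; yes; no)
  open import Relation.Binary.PropositionalEquality as ≡ using (_≡_; cong)
  import Algebra.Properties.CommutativeMonoid.Sum as CommutativeMonoidSum
  import Algebra.Properties.CommutativeSemigroup as CommutativeSemigroupProperties
  open Equivalence using (to; from)
  open CommutativeRing R hiding (zero)
  open CommutativeSemigroupProperties +-commutativeSemigroup using (interchange)
  open import Relation.Binary.Reasoning.Setoid setoid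
  open MPoly R y z
  open FibreSums using (injective⇒permutation)
  open Contraction
  open _≅_

  module ∏ = CommutativeMonoidSum *-commutativeMonoid

  zOf : Mark → Carrier
  zOf a = z (w a) (d a)

  prodFin≡∏ : ∀ n f → prodFin n f ≡ ∏.sum f
  prodFin≡∏ zero    f = ≡.refl
  prodFin≡∏ (suc n) f = cong (f zero *_) (prodFin≡∏ n (f ∘ suc))

  M-≅ : ∀ E {V} {G H : Graph V E} → G ≅ H → M G ≈ M H
  M-≅ zero {V} {G} {H} i = begin
    prodFin V (zOf ∘ marks G)           ≡⟨ prodFin≡∏ V _ ⟩
    ∏.sum (zOf ∘ marks G)              ≡⟨ ∏.sum-cong-≗ (λ x → cong zOf (≡.sym (marks-relabel i x))) ⟩
    ∏.sum (zOf ∘ marks H ∘ relabel i)  ≈⟨ ∏.sum-permute (zOf ∘ marks H) (injective⇒permutation (relabel i) (relabel-injective i)) ⟨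
    ∏.sum (zOf ∘ marks H)              ≡⟨ prodFin≡∏ V _ ⟨
    prodFin V (zOf ∘ marks H)           ∎
  M-≅ (suc E) {zero} {G} i with proj₁ (ends G zero)
  ... | ()
  M-≅ (suc E) {suc V} {G} {H} i with proj₁ (ends G zero) ≟ proj₂ (ends G zero) | proj₁ (ends H zero) ≟ proj₂ (ends H zero)
  ... | yes _     | yes _     = *-congˡ (M-≅ E (≅-delete i zero))
  ... | yes loop  | no nonLoop = ⊥-elim (nonLoop (to (≅-preservesLoop i zero) loop))
  ... | no nonLoop | yes loop  = ⊥-elim (nonLoop (from (≅-preservesLoop i zero) loop))
  ... | no nlG    | no nlH    = +-cong (M-≅ E (≅-delete i zero)) (M-≅ E (≅-contract i zero nlG nlH))

  M-loop-zero : ∀ {V E} (G : Graph (suc V) (suc E)) → Loop G zero → M G ≈ y * M (delete G zero)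
  M-loop-zero G loop with proj₁ (ends G zero) ≟ proj₂ (ends G zero)
  ... | yes _      = refl
  ... | no nonLoop = ⊥-elim (nonLoop loop)

  -- M contracts along the proof produced by its own case split, which need not be nl.
  M-nonLoop-zero : ∀ {V E} (G : Graph (suc V) (suc E)) (nl : NonLoop G zero) →
                   M G ≈ M (delete G zero) + M (contract G zero nl)
  M-nonLoop-zero {E = E} G nl with proj₁ (ends G zero) ≟ proj₂ (ends G zero)
  ... | yes loop = ⊥-elim (nl loop)
  ... | no nl′   = +-congˡ (M-≅ E (≅-contract (≅-refl {G = G}) zero nl′ nl))

  M-loop : ∀ E {V} (G : Graph (suc V) (suc E)) e → Loop G e → M G ≈ y * M (delete G e)
  M-loop-afterFirst : ∀ E {V} (G : Graph (suc V) (suc (suc E))) e → Loop G (suc e) → Dec (Loop G zero) →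
                      M G ≈ y * M (delete G (suc e))

  M-loop E G zero loop = M-loop-zero G loop
  M-loop (suc E) G (suc e) loop = M-loop-afterFirst E G e loop (loop? G zero)

  M-loop-afterFirst E G e loop (yes loop₀) = begin
    M G                                      ≈⟨ M-loop-zero G loop₀ ⟩
    y * M (delete G zero)                    ≈⟨ *-congˡ (M-loop E (delete G zero) e loop) ⟩
    y * (y * M (delete (delete G zero) e))  ≈⟨ *-congˡ (M-loop-zero (delete G (suc e)) loop₀) ⟨
    y * M (delete G (suc e))                 ∎
  M-loop-afterFirst E {zero} G e loop (no nl₀) = ⊥-elim (nl₀ (Fin1-≡ _ _))
  M-loop-afterFirst E {suc V} G e loop (no nl₀) = begin
    M G                                          ≈⟨ M-nonLoop-zero G nl₀ ⟩
    M (delete G zero) + M (contract G zero nl₀)  ≈⟨ +-cong (M-loop E (delete G zero) e loop)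
                                                           (M-loop E (contract G zero nl₀) e (cong (mergeV nl₀) loop)) ⟩
    y * M (delete (delete G zero) e) + y * M (delete (contract G zero nl₀) e)  ≈⟨ distribˡ y _ _ ⟨
    y * (M (delete (delete G zero) e) + M (delete (contract G zero nl₀) e))    ≈⟨ *-congˡ (M-nonLoop-zero (delete G (suc e)) nl₀) ⟨
    y * M (delete G (suc e))                     ∎

  M-deleteContract : ∀ E {V} (G : Graph (suc V) (suc E)) e (nl : NonLoop G e) →
                     M G ≈ M (delete G e) + M (contract G e nl)
  M-deleteContract-afterLoop : ∀ E {V} (G : Graph (suc (suc V)) (suc (suc E))) e (nl : NonLoop G (suc e)) →
                               Loop G zero → M G ≈ M (delete G (suc e)) + M (contract G (suc e) nl)
  M-deleteContract-parallel : ∀ E {V} (G : Graph (suc (suc V)) (suc (suc E))) e (nl : NonLoop G (suc e))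
                                (nl₀ : NonLoop G zero) → Loop (contract G zero nl₀) e →
                              M G ≈ M (delete G (suc e)) + M (contract G (suc e) nl)
  M-deleteContract-commuting : ∀ E {V} (G : Graph (suc (suc V)) (suc (suc E))) e (nl : NonLoop G (suc e))
                                 (nl₀ : NonLoop G zero) → NonLoop (contract G zero nl₀) e →
                               M G ≈ M (delete G (suc e)) + M (contract G (suc e) nl)

  M-deleteContract E G zero nl = M-nonLoop-zero G nl
  M-deleteContract (suc E) {zero} G (suc e) nl = ⊥-elim (nl (Fin1-≡ _ _))
  M-deleteContract (suc E) {suc V} G (suc e) nl = byFirstEdge (loop? G zero)
    where
    byFirstEdge : Dec (Loop G zero) → M G ≈ M (delete G (suc e)) + M (contract G (suc e) nl)
    byFirstEdge (yes loop₀) = M-deleteContract-afterLoop E G e nl loop₀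
    byFirstEdge (no nl₀) with loop? (contract G zero nl₀) e
    ... | yes parallel = M-deleteContract-parallel E G e nl nl₀ parallel
    ... | no nl′       = M-deleteContract-commuting E G e nl nl₀ nl′

  M-deleteContract-afterLoop E G e nl loop₀ = begin
    M G                                                                       ≈⟨ M-loop-zero G loop₀ ⟩
    y * M (delete G zero)                                                     ≈⟨ *-congˡ (M-deleteContract E (delete G zero) e nl) ⟩
    y * (M (delete (delete G zero) e) + M (contract (delete G zero) e nl))   ≈⟨ distribˡ y _ _ ⟩
    y * M (delete (delete G zero) e) + y * M (contract (delete G zero) e nl)
      ≈⟨ +-cong (M-loop-zero (delete G (suc e)) loop₀) (M-loop-zero (contract G (suc e) nl) (cong (mergeV nl) loop₀)) ⟨
    M (delete G (suc e)) + M (contract G (suc e) nl)                          ∎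

  M-deleteContract-parallel E G e nl nl₀ parallel = begin
    M G                                                                                                     ≈⟨ M-nonLoop-zero G nl₀ ⟩
    M (delete G zero) + M (contract G zero nl₀)
      ≈⟨ +-cong (M-deleteContract E (delete G zero) e nl) (M-loop E (contract G zero nl₀) e parallel) ⟩
    (M (delete (delete G zero) e) + M (contract (delete G zero) e nl)) + y * M (delete (contract G zero nl₀) e)
      ≈⟨ +-cong (+-congˡ same) (*-congˡ (sym same)) ⟩
    (M (delete (delete G zero) e) + M (delete (contract G zero nl₀) e)) + y * M (contract (delete G zero) e nl)
      ≈⟨ +-cong (M-nonLoop-zero (delete G (suc e)) nl₀) (M-loop-zero (contract G (suc e) nl) (mergeV-loop-swap nl₀ nl parallel)) ⟨
    M (delete G (suc e)) + M (contract G (suc e) nl)                                                        ∎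
    where
    same = M-≅ E (contract-parallel-≅ G e nl₀ nl parallel)

  M-deleteContract-commuting E G e nl nl₀ nl′ = begin
    M G                                                                                                     ≈⟨ M-nonLoop-zero G nl₀ ⟩
    M (delete G zero) + M (contract G zero nl₀)
      ≈⟨ +-cong (M-deleteContract E (delete G zero) e nl) (M-deleteContract E (contract G zero nl₀) e nl′) ⟩
    (M (delete (delete G zero) e) + M (contract (delete G zero) e nl))
      + (M (delete (contract G zero nl₀) e) + M (contract (contract G zero nl₀) e nl′))               ≈⟨ interchange _ _ _ _ ⟩
    (M (delete (delete G zero) e) + M (delete (contract G zero nl₀) e))
      + (M (contract (delete G zero) e nl) + M (contract (contract G zero nl₀) e nl′))                ≈⟨ +-congˡ (+-congˡ commute) ⟩
    (M (delete (delete G zero) e) + M (delete (contract G zero nl₀) e))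
      + (M (contract (delete G zero) e nl) + M (contract (contract G (suc e) nl) zero nl₀′))
      ≈⟨ +-cong (M-nonLoop-zero (delete G (suc e)) nl₀) (M-nonLoop-zero (contract G (suc e) nl) nl₀′) ⟨
    M (delete G (suc e)) + M (contract G (suc e) nl)                                                        ∎
    where
    nl₀′ : NonLoop (contract G (suc e) nl) zero
    nl₀′ = nl′ ∘ mergeV-loop-swap nl nl₀
    commute = M-≅ E (contract-comm-≅ G e nl₀ nl nl′ nl₀′)

proposition4p7 : ∀ {c l : Level} (R : CommutativeRing c l)
    (y : CommutativeRing.Carrier R) (z : ℕ → ℕ → CommutativeRing.Carrier R)
    {V E : ℕ} (G : Graph (suc V) (suc E)) (e : Fin (suc E)) (nl : NonLoop G e) →
    let open CommutativeRing R
        open MPoly R y z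
    in (M (contract G e nl) ≈ M (nearContract G e nl) - M (delete (nearContract G e nl) ℓ))
     × (M G ≈ M (delete G e) - M (delete (nearContract G e nl) ℓ) + M (nearContract G e nl))
proposition4p7 R y z {E = E} G e nl = contract≈near-deleteℓ , deletion-nearContraction
  where
  open CommutativeRing R
  open MPoly R y z
  open DeletionContraction R y z
  open Contraction using (nearContract-ℓ-nonLoop; contract-nearContract-≅)
  open import Algebra.Properties.AbelianGroup +-abelianGroup using (xyx⁻¹≈y)
  open import Relation.Binary.Reasoning.Setoid setoid
  open import Data.Product using (_,_)
  N = nearContract G e nl
  contract≈near-deleteℓ : M (contract G e nl) ≈ M N - M (delete N ℓ)
  contract≈near-deleteℓ = begin
    M (contract G e nl)                                                    ≈⟨ M-≅ E (contract-nearContract-≅ G e nl) ⟩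
    M (contract N ℓ (nearContract-ℓ-nonLoop G e nl))                       ≈⟨ xyx⁻¹≈y (M (delete N ℓ)) _ ⟨
    M (delete N ℓ) + M (contract N ℓ (nearContract-ℓ-nonLoop G e nl)) - M (delete N ℓ)  ≈⟨ +-congʳ (M-nonLoop-zero N _) ⟨
    M N - M (delete N ℓ)                                                   ∎
  deletion-nearContraction : M G ≈ M (delete G e) - M (delete N ℓ) + M N
  deletion-nearContraction = begin
    M G                                            ≈⟨ M-deleteContract E G e nl ⟩
    M (delete G e) + M (contract G e nl)           ≈⟨ +-congˡ contract≈near-deleteℓ ⟩
    M (delete G e) + (M N - M (delete N ℓ))        ≈⟨ +-congˡ (+-comm (M N) _) ⟩
    M (delete G e) + (- M (delete N ℓ) + M N)      ≈⟨ +-assoc _ _ _ ⟨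
    M (delete G e) - M (delete N ℓ) + M N          ∎
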